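{- For any sequence of operations on one-root hollow heaps (as defined and implemented in the context), starting with no heaps, the amortized time per operation is $O(1)$ for each operation other than delete and delete-min, and $O(\log N)$ for each delete or delete-min on a heap of $N$ nodes (full and hollow).
   Context: Heaps. A heap stores a finite set of items, each with a key from a totally ordered universe, and supports: make-heap() (return an empty heap); find-min($h$) (return an item of minimum key in $h$, or null if $h$ is empty); insert($e,k,h$) (add item $e$, which is in no heap, with key $k$); delete-min($h$) (delete from non-empty $h$ the item that find-min($h$) returns); meld($h_1,h_2$) (return a heap containing all items of the item-disjoint heaps $h_1,h_2$); decrease-key($e,k,h$) (given an item $e$ in $h$ with key greater than $k$, change its key to $k$); delete($e,h$) (delete item $e$ from $h$). Heaps passed as arguments are destroyed; decrease-key and delete are given the location of $e$. Nodes. Nodes hold items: each node holds at most one item, and is full if it holds one and hollow otherwise; each item in a heap is held by exactly one node; a newly created node is full and a hollow node never becomes full again. Each node $u$ has a key $u.key$ (the current key of its item if $u$ is full; if $u$ is hollow, the key its item had just before leaving $u$) and a non-negative integer rank $u.rank$. A tree (or dag) of nodes with arcs from parent to child is heap-ordered if $v.key\le w.key$ for every arc $(v,w)$. For two full roots, link makes the one of larger key (ties broken arbitrarily) a child of the other; the new child is the loser and the other the winner. A ranked link is a link of two roots of equal rank and increases the winner's rank by one; an unranked link may be applied to any two full roots and changes no ranks. One-root hollow heap. It is either empty or a single heap-ordered rooted tree of nodes whose root is full; the root is the minimum node. A non-root node is a ranked or unranked child according to whether the link it lost was ranked or unranked; a child keeps this status when moved to a new parent. make-heap returns an empty heap;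 find-min returns the item in the root; meld returns one heap if the other is empty, and otherwise does an unranked link of the two roots; insert($e,k,h$) creates a new full node of rank 0 holding $e$ with key $k$ and melds this one-node heap with $h$. decrease-key($e,k,h$), with $u$ the node holding $e$: if $u$ is the root one may simply set $u.key=k$; otherwise create a new node $v$, move $e$ from $u$ to $v$ (so $u$ becomes hollow), set $v.key=k$ and $v.rank=\max\{0,u.rank-2\}$, move to $v$ every ranked child of $u$ of rank less than $v.rank$ and any subset of the unranked children of $u$ (with their subtrees), and meld the tree rooted at $v$ with the heap. delete($e,h$) removes $e$ from the node $u$ holding it, making $u$ hollow; if $u$ is not the root this completes the operation; otherwise, while some root is hollow, destroy such a root, making its children roots; then do ranked links while two roots have equal rank; then do unranked links until one root remains. delete-min($h$) performs delete on the item in the root. Implementation. The children of each node are kept in a singly-linked circular list accessed via its last element, with the ranked children first in decreasing order by rank followed by the unranked children: a ranked link adds the loser at the front of the winner's list, an unranked link at the back. A decrease-key moving an item from $u$ to $v$ moves to $v$ all but the first two children of $u$ (with their subtrees) if $u.rank>2$, and no children otherwise. During delete, roots of equal rank to be linked are found using an array of roots indexed by rank. -}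

module Defs where

open import Level using (Level) renaming (_⊔_ to _⊔ˡ_)
open import Data.Bool using (if_then_else_)
open import Data.Nat using (ℕ; zero; suc; _+_; _*_; _∸_; _⊔_; _<ᵇ_)
open import Data.Nat.Logarithm using (⌊log₂_⌋)
open import Data.List using (List; []; _∷_; _++_; [_]; map; sum; length; foldr; take; drop)
open import Data.List.Relation.Unary.Unique.Propositional using (Unique)
open import Data.List.Relation.Binary.Permutation.Propositional using (_↭_)
open import Data.Maybe using (Maybe; just; nothing)
open import Data.Product using (_×_; _,_; Σ; proj₁; proj₂)
open import Relation.Binary.Bundles using (TotalOrder)
open import Relation.Binary.PropositionalEquality using (_≡_; _≢_)
open import Relation.Nullary using (¬_)

-- The semantics is relational: every
-- freedom the paper leaves open (tie-breaking in links, which pairs of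
-- roots are linked and in which order during delete, whether to simply
-- lower the key of a root in decrease-key) is allowed.

module HollowHeap {a ℓ₁ ℓ₂ : Level} (O : TotalOrder a ℓ₁ ℓ₂) where

  open TotalOrder O using (_≤_) renaming (Carrier to Key)

  Item : Set
  Item = ℕ

  _<ₖ_ : Key → Key → Set ℓ₂
  x <ₖ y = x ≤ y × ¬ (y ≤ x)

  -- status of a child: did it lose a ranked or an unranked link
  data Tag : Set where
    ranked unranked : Tag

  -- a node: held item (nothing = hollow), key, rank, and the list of
  -- children (ranked children first by decreasing rank, then unranked)
  data Node : Set a where
    node : Maybe Item → Key → ℕ → List (Tag × Node) → Node

  item : Node → Maybe Item
  item (node i _ _ _) = i

  key : Node → Key
  key (node _ k _ _) = k

  rank : Node → ℕ
  rank (node _ _ r _) = r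

  size : Node → ℕ
  sizeL : List (Tag × Node) → ℕ
  size (node _ _ _ cs) = suc (sizeL cs)
  sizeL [] = 0
  sizeL ((_ , c) ∷ cs) = size c + sizeL cs

  hollow : Node → Node
  hollow (node _ k r cs) = node nothing k r cs

  data RankedLink : Node → Node → Node → Set (a ⊔ˡ ℓ₂) where
    rlink : ∀ {e₁ e₂ k₁ k₂ r cs₁ cs₂} → k₁ ≤ k₂ →
            RankedLink (node (just e₁) k₁ r cs₁) (node (just e₂) k₂ r cs₂)
                       (node (just e₁) k₁ (suc r) ((ranked , node (just e₂) k₂ r cs₂) ∷ cs₁))

  data UnrankedLink : Node → Node → Node → Set (a ⊔ˡ ℓ₂) where
    ulink : ∀ {e₁ e₂ k₁ k₂ r₁ r₂ cs₁ cs₂} → k₁ ≤ k₂ →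
            UnrankedLink (node (just e₁) k₁ r₁ cs₁) (node (just e₂) k₂ r₂ cs₂)
                         (node (just e₁) k₁ r₁ (cs₁ ++ [ (unranked , node (just e₂) k₂ r₂ cs₂) ]))

  Heap : Set a
  Heap = Maybe Node

  -- meld; the ℕ index is the number of links performed
  data Meld : Heap → Heap → Heap → ℕ → Set (a ⊔ˡ ℓ₂) where
    emptyˡ : ∀ {h} → Meld nothing h h 0
    emptyʳ : ∀ {t} → Meld (just t) nothing (just t) 0
    link₁  : ∀ {t₁ t₂ w} → UnrankedLink t₁ t₂ w → Meld (just t₁) (just t₂) (just w) 1
    link₂  : ∀ {t₁ t₂ w} → UnrankedLink t₂ t₁ w → Meld (just t₁) (just t₂) (just w) 1

  -- Sub u u' t t' : t' is t with one occurrence of the subtree u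
  -- replaced by u'  (SubL: the same, strictly inside a child list)
  data Sub (u u' : Node) : Node → Node → Set a
  data SubL (u u' : Node) : List (Tag × Node) → List (Tag × Node) → Set a

  data Sub u u' where
    here  : Sub u u' u u'
    below : ∀ {i k r cs cs'} → SubL u u' cs cs' → Sub u u' (node i k r cs) (node i k r cs')

  data SubL u u' where
    hd : ∀ {t c c' cs} → Sub u u' c c' → SubL u u' ((t , c) ∷ cs) ((t , c') ∷ cs)
    tl : ∀ {x cs cs'} → SubL u u' cs cs' → SubL u u' (x ∷ cs) (x ∷ cs')

  Holds : Item → Node → Set a
  Holds e t = Σ Node (λ u → Sub u u t t × item u ≡ just e)

  dkSplit : Node → Key → Node × Node
  dkSplit (node i k₀ r cs) k =
    if 2 <ᵇ r
    then (node nothing k₀ r (take 2 cs) , node i k (r ∸ 2) (drop 2 cs))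
    else (node nothing k₀ r cs , node i k (r ∸ 2) [])

  fullRoots : Node → List Node
  fullRootsL : List (Tag × Node) → List Node
  fullRoots (node (just e) k r cs) = node (just e) k r cs ∷ []
  fullRoots (node nothing k r cs) = fullRootsL cs
  fullRootsL [] = []
  fullRootsL ((_ , c) ∷ cs) = fullRoots c ++ fullRootsL cs

  hollowCount : Node → ℕ
  hollowCountL : List (Tag × Node) → ℕ
  hollowCount (node (just _) _ _ _) = 0
  hollowCount (node nothing _ _ cs) = suc (hollowCountL cs)
  hollowCountL [] = 0
  hollowCountL ((_ , c) ∷ cs) = hollowCount c + hollowCountL cs

  -- delete, phase 2: ranked links while two roots have equal rank
  -- (any pair, any order); index = number of links
  data RankedPhase : List Node → List Node → ℕ → Set (a ⊔ˡ ℓ₂) where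
    stop : ∀ {rs} → Unique (map rank rs) → RankedPhase rs rs 0
    perm : ∀ {rs rs' out n} → rs ↭ rs' → RankedPhase rs' out n → RankedPhase rs out n
    link : ∀ {x y w rs out n} → RankedLink x y w →
           RankedPhase (w ∷ rs) out n → RankedPhase (x ∷ y ∷ rs) out (suc n)

  data UnrankedPhase : List Node → Heap → ℕ → Set (a ⊔ˡ ℓ₂) where
    none : UnrankedPhase [] nothing 0
    one  : ∀ {t} → UnrankedPhase (t ∷ []) (just t) 0
    perm : ∀ {rs rs' out n} → rs ↭ rs' → UnrankedPhase rs' out n → UnrankedPhase rs out n
    link : ∀ {x y w rs out n} → UnrankedLink x y w →
           UnrankedPhase (w ∷ rs) out n → UnrankedPhase (x ∷ y ∷ rs) out (suc n)

  maxRank : List Node → ℕ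
  maxRank rs = foldr _⊔_ 0 (map rank rs)

  -- Global state: a list of heap slots indexed by handles (ℕ); a heap
  -- passed as argument to meld is destroyed (slot becomes dead).

  data Slot : Set a where
    dead : Slot
    live : Heap → Slot

  State : Set a
  State = List Slot

  slot : State → ℕ → Slot
  slot [] _ = dead
  slot (x ∷ s) zero = x
  slot (x ∷ s) (suc h) = slot s h

  setSlot : State → ℕ → Slot → State
  setSlot [] _ _ = []
  setSlot (x ∷ s) zero y = y ∷ s
  setSlot (x ∷ s) (suc h) y = x ∷ setSlot s h y

  InSomeHeap : Item → State → Set a
  InSomeHeap e s = Σ ℕ (λ h → Σ Node (λ t → slot s h ≡ live (just t) × Holds e t))

  -- kind of an operation, for the amortized bound:
  -- a delete / delete-min on a heap with N nodes, or any other operation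
  data Kind : Set where
    other : Kind
    del   : ℕ → Kind

  -- Cost model (actual time, in
  -- units of O(1) work): 1 per operation, plus 1 per link, plus, for a
  -- delete of the root, 1 per hollow node destroyed, 1 per full root
  -- produced, and 1 + (largest rank) for the rank-indexed array.
  data Step : State → State → ℕ → Kind → Set (a ⊔ˡ ℓ₂) where
    make-heap : ∀ {s} → Step s (s ++ [ live nothing ]) 1 other
    find-min  : ∀ {s h m} → slot s h ≡ live m → Step s s 1 other
    insert    : ∀ {s h m m' l} (e : Item) (k : Key) →
                slot s h ≡ live m → ¬ InSomeHeap e s →
                Meld (just (node (just e) k 0 [])) m m' l →
                Step s (setSlot s h (live m')) (suc l) other
    meld      : ∀ {s h₁ h₂ m₁ m₂ m l} → h₁ ≢ h₂ →
                slot s h₁ ≡ live m₁ → slot s h₂ ≡ live m₂ → Meld m₁ m₂ m l →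
                Step s (setSlot (setSlot s h₂ dead) h₁ (live m)) (suc l) other
    decrease-key-root :
                ∀ {s h e k₀ r cs} (k : Key) →
                slot s h ≡ live (just (node (just e) k₀ r cs)) → k <ₖ k₀ →
                Step s (setSlot s h (live (just (node (just e) k r cs)))) 1 other
    decrease-key :
                ∀ {s h i kt rt cs cs' u m l} (e : Item) (k : Key) →
                slot s h ≡ live (just (node i kt rt cs)) →
                SubL u (proj₁ (dkSplit u k)) cs cs' → item u ≡ just e → k <ₖ key u →
                Meld (just (node i kt rt cs')) (just (proj₂ (dkSplit u k))) m l →
                Step s (setSlot s h (live m)) (suc l) other
    delete-nonroot :
                ∀ {s h i kt rt cs cs' u} (e : Item) →
                slot s h ≡ live (just (node i kt rt cs)) →
                SubL u (hollow u) cs cs' → item u ≡ just e →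
                Step s (setSlot s h (live (just (node i kt rt cs'))))
                     1 (del (size (node i kt rt cs)))
    -- delete of the item in the root (this is also delete-min)
    delete-root :
                ∀ {s h e k r cs rs m n₁ n₂} →
                slot s h ≡ live (just (node (just e) k r cs)) →
                RankedPhase (fullRootsL cs) rs n₁ → UnrankedPhase rs m n₂ →
                Step s (setSlot s h (live m))
                     (suc (suc (hollowCountL cs) + length (fullRootsL cs)
                            + n₁ + n₂ + suc (maxRank rs)))
                     (del (size (node (just e) k r cs)))

  data Exec : State → State → ℕ → List Kind → Set (a ⊔ˡ ℓ₂) where
    []  : ∀ {s} → Exec s s 0 []
    _∷_ : ∀ {s s' s'' c cs k ks} → Step s s' c k → Exec s' s'' cs ks →
          Exec s s'' (c + cs) (k ∷ ks)

  allowance : ℕ → Kind → ℕ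
  allowance c other = c
  allowance c (del N) = c * suc ⌊log₂ N ⌋

-- Give a full node one unit of potential per unranked child and a hollow node one unit for
-- itself plus one per child. A meld adds one unranked child, and a decrease-key hollows one node
-- and creates another, raising the potential by at most 3 since the new node takes over all but
-- two ranked children; a delete of a non-root raises it by 1 + rank. When the root is deleted,
-- the hollow nodes destroyed release enough potential to pay for themselves and for collecting
-- the full roots below them; the remaining work (links, the rank-indexed array) is bounded by
-- ranks. Ranks are logarithmic: even a hollow node of rank r ≥ 2 keeps children of ranks r-1
-- and r-2, so its subtree has at least 2^⌊r/2⌋ nodes, and after the ranked links the roots have
-- distinct ranks, so there are O(log N) of them.
module Submission where

open import Defs
open import Level using (Level)
open import Data.Nat
open import Data.Nat.Properties
open import Data.Nat.Logarithm using (⌊log₂_⌋; ⌊log₂⌋-mono-≤; ⌊log₂[2^n]⌋≡n)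
open import Data.Nat.ListAction using (sum)
open import Data.Nat.ListAction.Properties using (sum-++; sum-↭)
open import Data.Nat.Tactic.RingSolver using (solve-∀)
open import Data.List using (List; []; _∷_; _++_; [_]; map; length; filter)
open import Data.List.Properties using (length-map; length-++; map-++; filter-all; filter-accept; filter-reject)
open import Data.List.Relation.Unary.All as All using (All; []; _∷_)
import Data.List.Relation.Unary.All.Properties as All
open import Data.List.Relation.Unary.Unique.Propositional using (Unique; []; _∷_)
import Data.List.Relation.Unary.Unique.Propositional.Properties as Unique
open import Data.List.Relation.Binary.Permutation.Propositional using (_↭_)
import Data.List.Relation.Binary.Permutation.Propositional.Properties as ↭
open import Data.Maybe using (Maybe; just; nothing)
import Data.Maybe.Relation.Unary.All as Maybe
open import Data.Product using (_×_; _,_; Σ; proj₁; proj₂)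
open import Data.Unit.Polymorphic using (⊤; tt)
open import Data.Empty using (⊥-elim)
open import Function using (_∘_)
open import Relation.Binary.Bundles using (TotalOrder)
open import Relation.Binary.PropositionalEquality using (_≡_; _≢_; refl; sym; trans; cong; cong₂; subst; ≢-sym; module ≡-Reasoning)
open import Relation.Nullary using (yes; no; ¬?)
open import Algebra.Properties.CommutativeSemigroup +-commutativeSemigroup using (xy∙z≈xz∙y; x∙yz≈xz∙y; x∙yz≈y∙xz; xy∙z≈zy∙x)

length≤1+length-filter≢ : ∀ m {xs} → Unique xs →
                           length xs ≤ suc (length (filter (λ x → ¬? (x ≟ m)) xs))
length≤1+length-filter≢ m [] = z≤n
length≤1+length-filter≢ m {x ∷ xs} (x∉xs ∷ u) with x ≟ m
... | yes refl rewrite filter-reject (λ x → ¬? (x ≟ m)) {x} {xs} (λ x≢x → x≢x refl)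
                     | filter-all (λ x → ¬? (x ≟ m)) (All.map ≢-sym x∉xs) = ≤-refl
... | no x≢m rewrite filter-accept (λ x → ¬? (x ≟ m)) {x} {xs} x≢m =
  s≤s (length≤1+length-filter≢ m u)

unique∧bounded⇒length≤ : ∀ m {xs} → Unique xs → All (_< m) xs → length xs ≤ m
unique∧bounded⇒length≤ zero [] [] = z≤n
unique∧bounded⇒length≤ zero (_ ∷ _) (() ∷ _)
unique∧bounded⇒length≤ (suc m) {xs} u bounded = ≤-trans (length≤1+length-filter≢ m u)
  (s≤s (unique∧bounded⇒length≤ m (Unique.filter⁺ ≢m? u)
    (All.zipWith below-m (All.all-filter ≢m? xs , All.filter⁺ ≢m? bounded))))
  where
  ≢m? = λ x → ¬? (x ≟ m)
  below-m : ∀ {x} → x ≢ m × x < suc m → x < m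
  below-m (x≢m , x<1+m) = ≤∧≢⇒< (≤-pred x<1+m) x≢m

n≤2*⌊n/2⌋+1 : ∀ n → n ≤ 2 * ⌊ n /2⌋ + 1
n≤2*⌊n/2⌋+1 0 = z≤n
n≤2*⌊n/2⌋+1 1 = ≤-refl
n≤2*⌊n/2⌋+1 (suc (suc n)) = ≤-trans (s≤s (s≤s (n≤2*⌊n/2⌋+1 n))) (≤-reflexive (shift ⌊ n /2⌋))
  where
  shift : ∀ h → 2 + (2 * h + 1) ≡ 2 * suc h + 1
  shift = solve-∀

rankBound : ℕ → ℕ
rankBound N = 2 * ⌊log₂ N ⌋ + 1

2^⌊n/2⌋≤N⇒n≤rankBound : ∀ {n N} → 2 ^ ⌊ n /2⌋ ≤ N → n ≤ rankBound N
2^⌊n/2⌋≤N⇒n≤rankBound {n} {N} 2^≤N = ≤-trans (n≤2*⌊n/2⌋+1 n)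
  (+-monoˡ-≤ 1 (*-monoʳ-≤ 2 ⌊n/2⌋≤⌊log₂N⌋))
  where
  ⌊n/2⌋≤⌊log₂N⌋ : ⌊ n /2⌋ ≤ ⌊log₂ N ⌋
  ⌊n/2⌋≤⌊log₂N⌋ = ≤-trans (≤-reflexive (sym (⌊log₂[2^n]⌋≡n ⌊ n /2⌋))) (⌊log₂⌋-mono-≤ 2^≤N)

sum-map-++ : ∀ {ℓ} {A : Set ℓ} (f : A → ℕ) xs ys → sum (map f (xs ++ ys)) ≡ sum (map f xs) + sum (map f ys)
sum-map-++ f xs ys = trans (cong sum (map-++ f xs ys)) (sum-++ (map f xs) (map f ys))

sum-map-↭ : ∀ {ℓ} {A : Set ℓ} (f : A → ℕ) {xs ys} → xs ↭ ys → sum (map f xs) ≡ sum (map f ys)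
sum-map-↭ f p = sum-↭ (↭.map⁺ f p)

-- Actual cost c, potential X before and Y after. Potential counts twice: a delete-min pays each
-- collected root once for being collected and once for the ranked link it may lose.
record Amortized (c A X Y : ℕ) : Set where
  constructor amortized
  field
    bound : c + 2 * Y ≤ A + 2 * X

amortized-transfer : ∀ {c A S S' X Y} → S' + X ≡ S + Y → Amortized c A X Y → Amortized c A S S'
amortized-transfer {c} {A} {S} {S'} {X} {Y} S'+X≡S+Y (amortized local) = amortized (+-cancelʳ-≤ (2 * X) _ _ (begin
    c + 2 * S' + 2 * X   ≡⟨ +-assoc c _ _ ⟩
    c + (2 * S' + 2 * X) ≡⟨ cong (c +_) (sym (*-distribˡ-+ 2 S' X)) ⟩
    c + 2 * (S' + X)     ≡⟨ cong (λ z → c + 2 * z) S'+X≡S+Y ⟩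
    c + 2 * (S + Y)      ≡⟨ cong (c +_) (*-distribˡ-+ 2 S Y) ⟩
    c + (2 * S + 2 * Y)  ≡⟨ x∙yz≈xz∙y c _ _ ⟩
    (c + 2 * Y) + 2 * S  ≤⟨ +-monoˡ-≤ (2 * S) local ⟩
    A + 2 * X + 2 * S    ≡⟨ xy∙z≈xz∙y A _ _ ⟩
    A + 2 * S + 2 * X    ∎))
  where open ≤-Reasoning

amortized-from-increase : ∀ {c A X Y} d → Y ≤ X + d → c + 2 * d ≤ A → Amortized c A X Y
amortized-from-increase {c} {A} {X} {Y} d Y≤X+d c+2d≤A = amortized (begin
  c + 2 * Y            ≤⟨ +-monoʳ-≤ c (*-monoʳ-≤ 2 Y≤X+d) ⟩
  c + 2 * (X + d)      ≡⟨ cong (c +_) (trans (*-distribˡ-+ 2 X d) (+-comm (2 * X) (2 * d))) ⟩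
  c + (2 * d + 2 * X)  ≡⟨ +-assoc c _ _ ⟨
  c + 2 * d + 2 * X    ≤⟨ +-monoˡ-≤ (2 * X) c+2d≤A ⟩
  A + 2 * X            ∎)
  where open ≤-Reasoning

amortized-++ : ∀ {c c' A A' X Y Z} → Amortized c A X Y → Amortized c' A' Y Z → Amortized (c + c') (A + A') X Z
amortized-++ {c} {c'} {A} {A'} {X} {Y} {Z} (amortized first) (amortized rest) = amortized (+-cancelʳ-≤ (2 * Y) _ _ (begin
    c + c' + 2 * Z + 2 * Y         ≡⟨ regroup c c' (2 * Z) (2 * Y) ⟩
    (c + 2 * Y) + (c' + 2 * Z)     ≤⟨ +-mono-≤ first rest ⟩
    (A + 2 * X) + (A' + 2 * Y)     ≡⟨ regroup′ A (2 * X) A' (2 * Y) ⟩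
    A + A' + 2 * X + 2 * Y         ∎))
  where
  open ≤-Reasoning
  regroup : ∀ c c' z y → c + c' + z + y ≡ (c + y) + (c' + z)
  regroup = solve-∀
  regroup′ : ∀ a x a' y → (a + x) + (a' + y) ≡ a + a' + x + y
  regroup′ = solve-∀

amortized⇒≤ : ∀ {c A Y} → Amortized c A 0 Y → c ≤ A
amortized⇒≤ {c} {A} {Y} (amortized bound) =
  ≤-trans (m≤m+n c (2 * Y)) (≤-trans bound (≤-reflexive (+-identityʳ A)))

cheapOperation-arithmetic : ∀ {l d} → l ≤ 1 → d ≤ 3 + l → suc l + 2 * d ≤ 12
cheapOperation-arithmetic l≤1 d≤3+l =
  ≤-trans (+-mono-≤ (s≤s l≤1) (*-monoʳ-≤ 2 (≤-trans d≤3+l (+-monoʳ-≤ 3 l≤1)))) (m≤m+n 10 2)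

deleteNonroot-arithmetic : ∀ {r B} → r ≤ B → 1 + 2 * suc r ≤ 6 * suc B
deleteNonroot-arithmetic {r} {B} r≤B = begin
  1 + 2 * suc r     ≤⟨ +-monoʳ-≤ 1 (*-monoʳ-≤ 2 (s≤s r≤B)) ⟩
  1 + 2 * suc B     ≤⟨ m≤m+n (1 + 2 * suc B) (3 + 4 * B) ⟩
  1 + 2 * suc B + (3 + 4 * B) ≡⟨ rearrange B ⟩
  6 * suc B         ∎
  where
  open ≤-Reasoning
  rearrange : ∀ B → 1 + 2 * suc B + (3 + 4 * B) ≡ 6 * suc B
  rearrange = solve-∀

deleteRoot-arithmetic : ∀ {h f n₁ n₂ M P r X B} →
                        h + f + P ≤ r + X → n₁ ≤ f → n₂ ≤ suc B → M ≤ B → r ≤ B →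
                         suc (suc h + f + n₁ + n₂ + suc M) + 2 * (P + n₂) ≤ 6 * suc B + 2 * X
deleteRoot-arithmetic {h} {f} {n₁} {n₂} {M} {P} {r} {X} {B} released n₁≤f n₂≤1+B M≤B r≤B = begin
    suc (suc h + f + n₁ + n₂ + suc M) + 2 * (P + n₂)
  ≡⟨ regroup h f n₁ n₂ M P ⟩
    3 + ((h + f + P) + (n₁ + P)) + 3 * n₂ + M
  ≤⟨ +-monoˡ-≤ M (+-monoˡ-≤ (3 * n₂) (+-monoʳ-≤ 3 (+-monoʳ-≤ (h + f + P) (+-monoˡ-≤ P n₁≤h+f)))) ⟩
    3 + ((h + f + P) + (h + f + P)) + 3 * n₂ + M
  ≤⟨ +-monoˡ-≤ M (+-monoˡ-≤ (3 * n₂) (+-monoʳ-≤ 3 (+-mono-≤ released released))) ⟩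
    3 + ((r + X) + (r + X)) + 3 * n₂ + M
  ≤⟨ +-mono-≤ (+-mono-≤ (+-monoʳ-≤ 3 (+-mono-≤ r+X≤B+X r+X≤B+X)) (*-monoʳ-≤ 3 n₂≤1+B)) M≤B ⟩
    3 + ((B + X) + (B + X)) + 3 * suc B + B
  ≡⟨ collect B X ⟩
    6 * suc B + 2 * X
  ∎
  where
  open ≤-Reasoning
  n₁≤h+f = ≤-trans n₁≤f (m≤n+m f h)
  r+X≤B+X = +-monoˡ-≤ X r≤B
  regroup : ∀ h f n₁ n₂ M P → suc (suc h + f + n₁ + n₂ + suc M) + 2 * (P + n₂)
                              ≡ 3 + ((h + f + P) + (n₁ + P)) + 3 * n₂ + M
  regroup = solve-∀
  collect : ∀ B X → 3 + ((B + X) + (B + X)) + 3 * suc B + B ≡ 6 * suc B + 2 * X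
  collect = solve-∀

module Analysis {a ℓ₁ ℓ₂ : Level} (O : TotalOrder a ℓ₁ ℓ₂) where
  open HollowHeap O

  Children : Set a
  Children = List (Tag × Node)

  data FullShape : ℕ → Children → Set a where
    []        : FullShape 0 []
    unranked∷ : ∀ {c cs} → FullShape 0 cs → FullShape 0 ((unranked , c) ∷ cs)
    ranked∷   : ∀ {r i k ds cs} → FullShape r cs → FullShape (suc r) ((ranked , node i k r ds) ∷ cs)

  -- What survives when a node becomes hollow; it is all the size bound needs.
  data HollowShape : ℕ → Children → Set a where
    rank0  : ∀ {cs} → HollowShape 0 cs
    rank1  : ∀ {c cs} → HollowShape 1 (c ∷ cs)
    rank2+ : ∀ {r t t' i k ds i' k' ds' cs} →
             HollowShape (suc (suc r)) ((t , node i k (suc r) ds) ∷ (t' , node i' k' r ds') ∷ cs)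

  FullShape⇒HollowShape : ∀ {r cs} → FullShape r cs → HollowShape r cs
  FullShape⇒HollowShape [] = rank0
  FullShape⇒HollowShape (unranked∷ _) = rank0
  FullShape⇒HollowShape (ranked∷ []) = rank1
  FullShape⇒HollowShape (ranked∷ (unranked∷ _)) = rank1
  FullShape⇒HollowShape (ranked∷ (ranked∷ _)) = rank2+

  NodeShape : Maybe Item → ℕ → Children → Set a
  NodeShape (just _) = FullShape
  NodeShape nothing  = HollowShape

  NodeShape⇒HollowShape : ∀ i {r cs} → NodeShape i r cs → HollowShape r cs
  NodeShape⇒HollowShape (just _) = FullShape⇒HollowShape
  NodeShape⇒HollowShape nothing shape = shape

  data WellShaped : Node → Set a where
    well-shaped : ∀ {i k r cs} → NodeShape i r cs → All (WellShaped ∘ proj₂) cs →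
                  WellShaped (node i k r cs)

  size≥2^⌊rank/2⌋ : ∀ {t} → WellShaped t → 2 ^ ⌊ rank t /2⌋ ≤ size t
  children-size≥2^⌊r/2⌋ : ∀ {r cs} → HollowShape r cs → All (WellShaped ∘ proj₂) cs →
                          2 ^ ⌊ r /2⌋ ≤ suc (sizeL cs)

  size≥2^⌊rank/2⌋ (well-shaped {i} shape wcs) = children-size≥2^⌊r/2⌋ (NodeShape⇒HollowShape i shape) wcs

  children-size≥2^⌊r/2⌋ rank0 _ = s≤s z≤n
  children-size≥2^⌊r/2⌋ rank1 _ = s≤s z≤n
  children-size≥2^⌊r/2⌋ (rank2+ {r} {t} {t'} {i} {k} {ds} {i'} {k'} {ds'} {cs}) (wc ∷ wd ∷ _) =
    begin
      2 ^ ⌊ r /2⌋ + (2 ^ ⌊ r /2⌋ + 0)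
    ≤⟨ +-mono-≤ (≤-trans (^-monoʳ-≤ 2 (⌊n/2⌋-mono (n≤1+n r))) (size≥2^⌊rank/2⌋ wc))
                (≤-trans (≤-reflexive (+-identityʳ _)) (size≥2^⌊rank/2⌋ wd)) ⟩
      size c + size d
    ≤⟨ +-monoʳ-≤ (size c) (m≤m+n (size d) (sizeL cs)) ⟩
      size c + (size d + sizeL cs)
    <⟨ n<1+n _ ⟩
      suc (size c + (size d + sizeL cs))
    ∎
    where
    open ≤-Reasoning
    c = node i k (suc r) ds
    d = node i' k' r ds'

  rank≤rankBound : ∀ {t N} → WellShaped t → size t ≤ N → rank t ≤ rankBound N
  rank≤rankBound wt size≤N = 2^⌊n/2⌋≤N⇒n≤rankBound (≤-trans (size≥2^⌊rank/2⌋ wt) size≤N)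

  unrankedCount : Children → ℕ
  unrankedCount [] = 0
  unrankedCount ((ranked , _) ∷ cs) = unrankedCount cs
  unrankedCount ((unranked , _) ∷ cs) = suc (unrankedCount cs)

  nodePotential : Maybe Item → Children → ℕ
  nodePotential (just _) cs = unrankedCount cs
  nodePotential nothing cs = suc (length cs)

  Φ : Node → ℕ
  Φᶜ : Children → ℕ
  Φ (node i _ _ cs) = nodePotential i cs + Φᶜ cs
  Φᶜ [] = 0
  Φᶜ ((_ , c) ∷ cs) = Φ c + Φᶜ cs

  length≡rank+unrankedCount : ∀ {r cs} → FullShape r cs → length cs ≡ r + unrankedCount cs
  length≡rank+unrankedCount [] = refl
  length≡rank+unrankedCount (unranked∷ shape) = cong suc (length≡rank+unrankedCount shape)
  length≡rank+unrankedCount (ranked∷ shape) = cong suc (length≡rank+unrankedCount shape)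

  data SameShape : Children → Children → Set a where
    []  : SameShape [] []
    _∷_ : ∀ {t c c' cs cs'} → rank c ≡ rank c' → SameShape cs cs' →
          SameShape ((t , c) ∷ cs) ((t , c') ∷ cs')

  SameShape-refl : ∀ cs → SameShape cs cs
  SameShape-refl [] = []
  SameShape-refl (_ ∷ cs) = refl ∷ SameShape-refl cs

  FullShape-resp-SameShape : ∀ {r cs cs'} → SameShape cs cs' → FullShape r cs → FullShape r cs'
  FullShape-resp-SameShape [] [] = []
  FullShape-resp-SameShape (_ ∷ same) (unranked∷ shape) = unranked∷ (FullShape-resp-SameShape same shape)
  FullShape-resp-SameShape {cs' = (_ , node _ _ _ _) ∷ _} (refl ∷ same) (ranked∷ shape) =
    ranked∷ (FullShape-resp-SameShape same shape)

  HollowShape-resp-SameShape : ∀ {r cs cs'} → SameShape cs cs' → HollowShape r cs → HollowShape r cs'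
  HollowShape-resp-SameShape _ rank0 = rank0
  HollowShape-resp-SameShape (_ ∷ _) rank1 = rank1
  HollowShape-resp-SameShape {cs' = (_ , node _ _ _ _) ∷ (_ , node _ _ _ _) ∷ _} (refl ∷ refl ∷ _) rank2+ = rank2+

  NodeShape-resp-SameShape : ∀ i {r cs cs'} → SameShape cs cs' → NodeShape i r cs → NodeShape i r cs'
  NodeShape-resp-SameShape (just _) = FullShape-resp-SameShape
  NodeShape-resp-SameShape nothing = HollowShape-resp-SameShape

  nodePotential-resp-SameShape : ∀ i {cs cs'} → SameShape cs cs' → nodePotential i cs ≡ nodePotential i cs'
  nodePotential-resp-SameShape (just _) = unranked-resp
    where
    unranked-resp : ∀ {cs cs'} → SameShape cs cs' → unrankedCount cs ≡ unrankedCount cs'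
    unranked-resp [] = refl
    unranked-resp {(ranked , _) ∷ _} (_ ∷ same) = unranked-resp same
    unranked-resp {(unranked , _) ∷ _} (_ ∷ same) = cong suc (unranked-resp same)
  nodePotential-resp-SameShape nothing = cong suc ∘ length-resp
    where
    length-resp : ∀ {cs cs'} → SameShape cs cs' → length cs ≡ length cs'
    length-resp [] = refl
    length-resp (_ ∷ same) = cong suc (length-resp same)

  WellShaped-sub : ∀ {u u' t t'} → Sub u u' t t' → WellShaped t → WellShaped u
  WellShaped-subL : ∀ {u u' cs cs'} → SubL u u' cs cs' → All (WellShaped ∘ proj₂) cs → WellShaped u
  WellShaped-sub here wt = wt
  WellShaped-sub (below sub) (well-shaped _ wcs) = WellShaped-subL sub wcs
  WellShaped-subL (hd sub) (wc ∷ _) = WellShaped-sub sub wc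
  WellShaped-subL (tl sub) (_ ∷ wcs) = WellShaped-subL sub wcs

  size-sub : ∀ {u u' t t'} → Sub u u' t t' → size u ≤ size t
  size-subL : ∀ {u u' cs cs'} → SubL u u' cs cs' → size u ≤ sizeL cs
  size-sub here = ≤-refl
  size-sub (below sub) = m≤n⇒m≤1+n (size-subL sub)
  size-subL (hd {c = c} {cs = cs} sub) = ≤-trans (size-sub sub) (m≤m+n (size c) (sizeL cs))
  size-subL (tl {x = _ , c} sub) = ≤-trans (size-subL sub) (m≤n+m _ (size c))

  module RankPreservingReplacement {u u' : Node} (rank≡ : rank u ≡ rank u') where

    SameShape-subL : ∀ {cs cs'} → SubL u u' cs cs' → SameShape cs cs'
    SameShape-subL (hd here) = rank≡ ∷ SameShape-refl _
    SameShape-subL (hd (below _)) = refl ∷ SameShape-refl _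
    SameShape-subL (tl {x = _ , _} sub) = refl ∷ SameShape-subL sub

    WellShaped-replace : ∀ {t t'} → Sub u u' t t' → WellShaped t → WellShaped u' → WellShaped t'
    WellShaped-replaceL : ∀ {cs cs'} → SubL u u' cs cs' → All (WellShaped ∘ proj₂) cs → WellShaped u' →
                          All (WellShaped ∘ proj₂) cs'
    WellShaped-replace here _ wu' = wu'
    WellShaped-replace (below {i = i} sub) (well-shaped shape wcs) wu' =
      well-shaped (NodeShape-resp-SameShape i (SameShape-subL sub) shape) (WellShaped-replaceL sub wcs wu')
    WellShaped-replaceL (hd sub) (wc ∷ wcs) wu' = WellShaped-replace sub wc wu' ∷ wcs
    WellShaped-replaceL (tl sub) (wc ∷ wcs) wu' = wc ∷ WellShaped-replaceL sub wcs wu'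

    Φ-replace : ∀ {t t'} → Sub u u' t t' → Φ t' + Φ u ≡ Φ t + Φ u'
    Φᶜ-replace : ∀ {cs cs'} → SubL u u' cs cs' → Φᶜ cs' + Φ u ≡ Φᶜ cs + Φ u'
    Φ-replace here = +-comm (Φ u') (Φ u)
    Φ-replace (below {i = i} {cs = cs} {cs' = cs'} sub) = begin
      nodePotential i cs' + Φᶜ cs' + Φ u   ≡⟨ +-assoc (nodePotential i cs') _ _ ⟩
      nodePotential i cs' + (Φᶜ cs' + Φ u) ≡⟨ cong₂ _+_ (sym (nodePotential-resp-SameShape i (SameShape-subL sub)))
                                                       (Φᶜ-replace sub) ⟩
      nodePotential i cs + (Φᶜ cs + Φ u')  ≡⟨ +-assoc (nodePotential i cs) _ _ ⟨
      nodePotential i cs + Φᶜ cs + Φ u'    ∎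
      where open ≡-Reasoning
    Φᶜ-replace (hd {c = c} {c' = c'} {cs = cs} sub) = begin
      Φ c' + Φᶜ cs + Φ u   ≡⟨ xy∙z≈xz∙y (Φ c') _ _ ⟩
      Φ c' + Φ u + Φᶜ cs   ≡⟨ cong (_+ Φᶜ cs) (Φ-replace sub) ⟩
      Φ c + Φ u' + Φᶜ cs   ≡⟨ xy∙z≈xz∙y (Φ c) _ _ ⟩
      Φ c + Φᶜ cs + Φ u'   ∎
      where open ≡-Reasoning
    Φᶜ-replace (tl {x = _ , c} {cs = cs} {cs' = cs'} sub) = begin
      Φ c + Φᶜ cs' + Φ u   ≡⟨ +-assoc (Φ c) _ _ ⟩
      Φ c + (Φᶜ cs' + Φ u) ≡⟨ cong (Φ c +_) (Φᶜ-replace sub) ⟩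
      Φ c + (Φᶜ cs + Φ u') ≡⟨ +-assoc (Φ c) _ _ ⟨
      Φ c + Φᶜ cs + Φ u'   ∎
      where open ≡-Reasoning

  unrankedCount-++ : ∀ xs ys → unrankedCount (xs ++ ys) ≡ unrankedCount xs + unrankedCount ys
  unrankedCount-++ [] ys = refl
  unrankedCount-++ ((ranked , _) ∷ xs) ys = unrankedCount-++ xs ys
  unrankedCount-++ ((unranked , _) ∷ xs) ys = cong suc (unrankedCount-++ xs ys)

  Φᶜ-++ : ∀ xs ys → Φᶜ (xs ++ ys) ≡ Φᶜ xs + Φᶜ ys
  Φᶜ-++ [] ys = refl
  Φᶜ-++ ((_ , c) ∷ xs) ys = trans (cong (Φ c +_) (Φᶜ-++ xs ys)) (sym (+-assoc (Φ c) _ _))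

  FullShape-∷ʳ-unranked : ∀ {r cs} y → FullShape r cs → FullShape r (cs ++ [ (unranked , y) ])
  FullShape-∷ʳ-unranked y [] = unranked∷ []
  FullShape-∷ʳ-unranked y (unranked∷ shape) = unranked∷ (FullShape-∷ʳ-unranked y shape)
  FullShape-∷ʳ-unranked y (ranked∷ shape) = ranked∷ (FullShape-∷ʳ-unranked y shape)

  Φ-unrankedLink : ∀ {x y w} → UnrankedLink x y w → Φ w ≡ Φ x + Φ y + 1
  Φ-unrankedLink (ulink {e₂ = e₂} {k₂ = k₂} {r₂ = r₂} {cs₁ = cs₁} {cs₂ = cs₂} _) = begin
      unrankedCount (cs₁ ++ [ (unranked , y) ]) + Φᶜ (cs₁ ++ [ (unranked , y) ])
    ≡⟨ cong₂ _+_ (unrankedCount-++ cs₁ _) (Φᶜ-++ cs₁ _) ⟩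
      (unrankedCount cs₁ + 1) + (Φᶜ cs₁ + (Φ y + 0))
    ≡⟨ rearrange (unrankedCount cs₁) (Φᶜ cs₁) (Φ y) ⟩
      unrankedCount cs₁ + Φᶜ cs₁ + Φ y + 1
    ∎
    where
    open ≡-Reasoning
    y = node (just e₂) k₂ r₂ cs₂
    rearrange : ∀ m p q → (m + 1) + (p + (q + 0)) ≡ m + p + q + 1
    rearrange = solve-∀

  WellShaped-unrankedLink : ∀ {x y w} → UnrankedLink x y w → WellShaped x → WellShaped y → WellShaped w
  WellShaped-unrankedLink (ulink _) (well-shaped shape wcs) wy =
    well-shaped (FullShape-∷ʳ-unranked _ shape) (All.++⁺ wcs (wy ∷ []))

  Φ-rankedLink : ∀ {x y w} → RankedLink x y w → Φ w ≡ Φ x + Φ y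
  Φ-rankedLink (rlink {e₂ = e₂} {k₂ = k₂} {r = r} {cs₁ = cs₁} {cs₂ = cs₂} _) =
    x∙yz≈xz∙y (unrankedCount cs₁) (Φ (node (just e₂) k₂ r cs₂)) (Φᶜ cs₁)

  size-rankedLink : ∀ {x y w} → RankedLink x y w → size w ≡ size x + size y
  size-rankedLink (rlink {e₂ = e₂} {k₂ = k₂} {r = r} {cs₁ = cs₁} {cs₂ = cs₂} _) =
    cong suc (+-comm (size (node (just e₂) k₂ r cs₂)) (sizeL cs₁))

  WellShaped-rankedLink : ∀ {x y w} → RankedLink x y w → WellShaped x → WellShaped y → WellShaped w
  WellShaped-rankedLink (rlink _) (well-shaped shape wcs) wy = well-shaped (ranked∷ shape) (wy ∷ wcs)

  Φʰ : Heap → ℕ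
  Φʰ nothing = 0
  Φʰ (just t) = Φ t

  WellShapedHeap : Heap → Set a
  WellShapedHeap = Maybe.All WellShaped

  Φʰ-meld : ∀ {m₁ m₂ m l} → Meld m₁ m₂ m l → Φʰ m ≡ Φʰ m₁ + Φʰ m₂ + l
  Φʰ-meld {m₂ = m₂} emptyˡ = sym (+-identityʳ (Φʰ m₂))
  Φʰ-meld {m₁ = just t} emptyʳ = sym (trans (+-identityʳ _) (+-identityʳ _))
  Φʰ-meld (link₁ ul) = Φ-unrankedLink ul
  Φʰ-meld {just t₁} {just t₂} (link₂ ul) = trans (Φ-unrankedLink ul) (cong (_+ 1) (+-comm (Φ t₂) (Φ t₁)))

  WellShaped-meld : ∀ {m₁ m₂ m l} → Meld m₁ m₂ m l → WellShapedHeap m₁ → WellShapedHeap m₂ → WellShapedHeap m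
  WellShaped-meld emptyˡ _ wm = wm
  WellShaped-meld emptyʳ wm _ = wm
  WellShaped-meld (link₁ ul) (Maybe.just wt₁) (Maybe.just wt₂) = Maybe.just (WellShaped-unrankedLink ul wt₁ wt₂)
  WellShaped-meld (link₂ ul) (Maybe.just wt₁) (Maybe.just wt₂) = Maybe.just (WellShaped-unrankedLink ul wt₂ wt₁)

  meld-links≤1 : ∀ {m₁ m₂ m l} → Meld m₁ m₂ m l → l ≤ 1
  meld-links≤1 emptyˡ = z≤n
  meld-links≤1 emptyʳ = z≤n
  meld-links≤1 (link₁ _) = ≤-refl
  meld-links≤1 (link₂ _) = ≤-refl

  rank-hollow : ∀ u → rank (hollow u) ≡ rank u
  rank-hollow (node _ _ _ _) = refl

  WellShaped-hollow : ∀ {e} u → item u ≡ just e → WellShaped u → WellShaped (hollow u)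
  WellShaped-hollow (node _ _ _ _) refl (well-shaped shape wcs) = well-shaped (FullShape⇒HollowShape shape) wcs

  Φ-hollow : ∀ {e} u → item u ≡ just e → WellShaped u → Φ (hollow u) ≡ Φ u + suc (rank u)
  Φ-hollow (node _ _ r cs) refl (well-shaped shape _) rewrite length≡rank+unrankedCount shape =
    rearrange r (unrankedCount cs) (Φᶜ cs)
    where
    rearrange : ∀ r m q → suc (r + m) + q ≡ m + q + suc r
    rearrange = solve-∀

  Φ-hollow-rank≤2 : ∀ {e} u → item u ≡ just e → WellShaped u → rank u ≤ 2 → Φ (hollow u) + 0 ≤ Φ u + 3
  Φ-hollow-rank≤2 u it wu rank≤2 = begin
    Φ (hollow u) + 0     ≡⟨ +-identityʳ _ ⟩
    Φ (hollow u)         ≡⟨ Φ-hollow u it wu ⟩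
    Φ u + suc (rank u)   ≤⟨ +-monoʳ-≤ (Φ u) (s≤s rank≤2) ⟩
    Φ u + 3              ∎
    where open ≤-Reasoning

  rank-dkSplit : ∀ u k → rank (proj₁ (dkSplit u k)) ≡ rank u
  rank-dkSplit (node _ _ 0 _) _ = refl
  rank-dkSplit (node _ _ 1 _) _ = refl
  rank-dkSplit (node _ _ 2 _) _ = refl
  rank-dkSplit (node _ _ (suc (suc (suc _))) _) _ = refl

  WellShaped-dkSplit : ∀ {e} u k → item u ≡ just e → WellShaped u →
                       WellShaped (proj₁ (dkSplit u k)) × WellShaped (proj₂ (dkSplit u k))
  WellShaped-dkSplit u@(node _ _ 0 _) _ refl wu = WellShaped-hollow u refl wu , well-shaped [] []
  WellShaped-dkSplit u@(node _ _ 1 _) _ refl wu = WellShaped-hollow u refl wu , well-shaped [] []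
  WellShaped-dkSplit u@(node _ _ 2 _) _ refl wu = WellShaped-hollow u refl wu , well-shaped [] []
  WellShaped-dkSplit (node _ _ (suc (suc (suc _))) _) _ refl
                     (well-shaped (ranked∷ (ranked∷ (ranked∷ shape))) (wc₁ ∷ wc₂ ∷ wcs)) =
    well-shaped rank2+ (wc₁ ∷ wc₂ ∷ []) , well-shaped (ranked∷ shape) wcs

  Φ-dkSplit : ∀ {e} u k → item u ≡ just e → WellShaped u →
              Φ (proj₁ (dkSplit u k)) + Φ (proj₂ (dkSplit u k)) ≤ Φ u + 3
  Φ-dkSplit u@(node _ _ 0 _) _ refl wu = Φ-hollow-rank≤2 u refl wu z≤n
  Φ-dkSplit u@(node _ _ 1 _) _ refl wu = Φ-hollow-rank≤2 u refl wu (s≤s z≤n)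
  Φ-dkSplit u@(node _ _ 2 _) _ refl wu = Φ-hollow-rank≤2 u refl wu ≤-refl
  Φ-dkSplit (node _ _ (suc (suc (suc _))) ((_ , c₁) ∷ (_ , c₂) ∷ (_ , c₃) ∷ cs)) _ refl
            (well-shaped (ranked∷ (ranked∷ (ranked∷ _))) _) =
    ≤-reflexive (rearrange (Φ c₁) (Φ c₂) (Φ c₃) (unrankedCount cs) (Φᶜ cs))
    where
    rearrange : ∀ p₁ p₂ p₃ m q → 3 + (p₁ + (p₂ + 0)) + (m + (p₃ + q)) ≡ m + (p₁ + (p₂ + (p₃ + q))) + 3
    rearrange = solve-∀

  -- A destroyed hollow node frees its potential 1 + (number of children): one unit pays for
  -- destroying it, one for each child that becomes a root.
  fullRoots-cost : ∀ t → hollowCount t + length (fullRoots t) + sum (map Φ (fullRoots t)) ≤ suc (Φ t)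
  fullRootsL-cost : ∀ cs → hollowCountL cs + length (fullRootsL cs) + sum (map Φ (fullRootsL cs))
                           ≤ length cs + Φᶜ cs
  fullRoots-cost (node (just _) _ _ _) = ≤-reflexive (cong suc (+-identityʳ _))
  fullRoots-cost (node nothing _ _ cs) = s≤s (≤-trans (fullRootsL-cost cs) (n≤1+n _))
  fullRootsL-cost [] = z≤n
  fullRootsL-cost ((_ , c) ∷ cs) = begin
      hollowCount c + hollowCountL cs + length (fullRoots c ++ fullRootsL cs) + sum (map Φ (fullRoots c ++ fullRootsL cs))
    ≡⟨ cong₂ (λ p q → hollowCount c + hollowCountL cs + p + q)
             (length-++ (fullRoots c)) (sum-map-++ Φ (fullRoots c) _) ⟩
      hollowCount c + hollowCountL cs + (length (fullRoots c) + length (fullRootsL cs))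
        + (sum (map Φ (fullRoots c)) + sum (map Φ (fullRootsL cs)))
    ≡⟨ regroup (hollowCount c) (hollowCountL cs) (length (fullRoots c)) (length (fullRootsL cs))
               (sum (map Φ (fullRoots c))) (sum (map Φ (fullRootsL cs))) ⟩
      (hollowCount c + length (fullRoots c) + sum (map Φ (fullRoots c)))
        + (hollowCountL cs + length (fullRootsL cs) + sum (map Φ (fullRootsL cs)))
    ≤⟨ +-mono-≤ (fullRoots-cost c) (fullRootsL-cost cs) ⟩
      suc (Φ c) + (length cs + Φᶜ cs)
    ≡⟨ cong suc (x∙yz≈y∙xz (Φ c) (length cs) (Φᶜ cs)) ⟩
      suc (length cs) + (Φ c + Φᶜ cs)
    ∎
    where
    open ≤-Reasoning
    regroup : ∀ h h' f f' p p' → h + h' + (f + f') + (p + p') ≡ (h + f + p) + (h' + f' + p')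
    regroup = solve-∀

  WellShaped-fullRoots : ∀ {t} → WellShaped t → All WellShaped (fullRoots t)
  WellShaped-fullRootsL : ∀ {cs} → All (WellShaped ∘ proj₂) cs → All WellShaped (fullRootsL cs)
  WellShaped-fullRoots {node (just _) _ _ _} wt = wt ∷ []
  WellShaped-fullRoots {node nothing _ _ _} (well-shaped _ wcs) = WellShaped-fullRootsL wcs
  WellShaped-fullRootsL [] = []
  WellShaped-fullRootsL (wc ∷ wcs) = All.++⁺ (WellShaped-fullRoots wc) (WellShaped-fullRootsL wcs)

  size-fullRoots : ∀ t → sum (map size (fullRoots t)) ≤ size t
  size-fullRootsL : ∀ cs → sum (map size (fullRootsL cs)) ≤ sizeL cs
  size-fullRoots (node (just _) _ _ _) = ≤-reflexive (+-identityʳ _)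
  size-fullRoots (node nothing _ _ cs) = m≤n⇒m≤1+n (size-fullRootsL cs)
  size-fullRootsL [] = z≤n
  size-fullRootsL ((_ , c) ∷ cs) =
    ≤-trans (≤-reflexive (sum-map-++ size (fullRoots c) _)) (+-mono-≤ (size-fullRoots c) (size-fullRootsL cs))

  RankedPhase-sum : ∀ (f : Node → ℕ) → (∀ {x y w} → RankedLink x y w → f w ≡ f x + f y) →
                    ∀ {rs out n} → RankedPhase rs out n → sum (map f out) ≡ sum (map f rs)
  RankedPhase-sum f additive (stop _) = refl
  RankedPhase-sum f additive (perm p phase) = trans (RankedPhase-sum f additive phase) (sym (sum-map-↭ f p))
  RankedPhase-sum f additive (link {x = x} {y = y} {rs = rs} l phase) =
    trans (RankedPhase-sum f additive phase) (trans (cong (_+ sum (map f rs)) (additive l)) (+-assoc (f x) (f y) _))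

  WellShaped-RankedPhase : ∀ {rs out n} → RankedPhase rs out n → All WellShaped rs → All WellShaped out
  WellShaped-RankedPhase (stop _) wrs = wrs
  WellShaped-RankedPhase (perm p phase) wrs = WellShaped-RankedPhase phase (↭.All-resp-↭ p wrs)
  WellShaped-RankedPhase (link l phase) (wx ∷ wy ∷ wrs) =
    WellShaped-RankedPhase phase (WellShaped-rankedLink l wx wy ∷ wrs)

  RankedPhase-links≤length : ∀ {rs out n} → RankedPhase rs out n → n ≤ length rs
  RankedPhase-links≤length (stop _) = z≤n
  RankedPhase-links≤length (perm p phase) =
    ≤-trans (RankedPhase-links≤length phase) (≤-reflexive (sym (↭.↭-length p)))
  RankedPhase-links≤length (link _ phase) = s≤s (RankedPhase-links≤length phase)

  RankedPhase-unique : ∀ {rs out n} → RankedPhase rs out n → Unique (map rank out)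
  RankedPhase-unique (stop u) = u
  RankedPhase-unique (perm _ phase) = RankedPhase-unique phase
  RankedPhase-unique (link _ phase) = RankedPhase-unique phase

  WellShaped-UnrankedPhase : ∀ {rs m n} → UnrankedPhase rs m n → All WellShaped rs → WellShapedHeap m
  WellShaped-UnrankedPhase none _ = Maybe.nothing
  WellShaped-UnrankedPhase one (wt ∷ []) = Maybe.just wt
  WellShaped-UnrankedPhase (perm p phase) wrs = WellShaped-UnrankedPhase phase (↭.All-resp-↭ p wrs)
  WellShaped-UnrankedPhase (link l phase) (wx ∷ wy ∷ wrs) =
    WellShaped-UnrankedPhase phase (WellShaped-unrankedLink l wx wy ∷ wrs)

  Φʰ-UnrankedPhase : ∀ {rs m n} → UnrankedPhase rs m n → Φʰ m ≡ sum (map Φ rs) + n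
  Φʰ-UnrankedPhase none = refl
  Φʰ-UnrankedPhase one = sym (trans (+-identityʳ _) (+-identityʳ _))
  Φʰ-UnrankedPhase (perm p phase) = trans (Φʰ-UnrankedPhase phase) (cong (_+ _) (sym (sum-map-↭ Φ p)))
  Φʰ-UnrankedPhase (link {x = x} {y = y} {rs = rs} {n = n} l phase) =
    trans (Φʰ-UnrankedPhase phase) (trans (cong (λ z → z + sum (map Φ rs) + n) (Φ-unrankedLink l))
                                          (rearrange (Φ x) (Φ y) (sum (map Φ rs)) n))
    where
    rearrange : ∀ p q s n → p + q + 1 + s + n ≡ p + (q + s) + suc n
    rearrange = solve-∀

  UnrankedPhase-links≤length : ∀ {rs m n} → UnrankedPhase rs m n → n ≤ length rs
  UnrankedPhase-links≤length none = z≤n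
  UnrankedPhase-links≤length one = z≤n
  UnrankedPhase-links≤length (perm p phase) =
    ≤-trans (UnrankedPhase-links≤length phase) (≤-reflexive (sym (↭.↭-length p)))
  UnrankedPhase-links≤length (link _ phase) = s≤s (UnrankedPhase-links≤length phase)

  ranks≤rankBound : ∀ {N} rs → All WellShaped rs → sum (map size rs) ≤ N →
                    All (λ t → rank t ≤ rankBound N) rs
  ranks≤rankBound [] [] _ = []
  ranks≤rankBound (t ∷ rs) (wt ∷ wrs) size≤N =
    rank≤rankBound wt (≤-trans (m≤m+n (size t) _) size≤N) ∷
    ranks≤rankBound rs wrs (≤-trans (m≤n+m _ (size t)) size≤N)

  maxRank≤ : ∀ {B} rs → All (λ t → rank t ≤ B) rs → maxRank rs ≤ B
  maxRank≤ [] [] = z≤n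
  maxRank≤ (_ ∷ rs) (rank≤B ∷ ranks≤B) = ⊔-lub rank≤B (maxRank≤ rs ranks≤B)

  length≤1+bound : ∀ {B} rs → Unique (map rank rs) → All (λ t → rank t ≤ B) rs → length rs ≤ suc B
  length≤1+bound {B} rs unique ranks≤B = ≤-trans (≤-reflexive (sym (length-map rank rs)))
    (unique∧bounded⇒length≤ (suc B) unique (All.map⁺ (All.map s≤s ranks≤B)))

  slotPotential : Slot → ℕ
  slotPotential dead = 0
  slotPotential (live m) = Φʰ m

  Φˢ : State → ℕ
  Φˢ s = sum (map slotPotential s)

  WellShapedSlot : Slot → Set a
  WellShapedSlot dead = ⊤
  WellShapedSlot (live m) = WellShapedHeap m

  WellShapedState : State → Set a
  WellShapedState = All WellShapedSlot

  Φˢ-setSlot : ∀ s h x {m} → slot s h ≡ live m → Φˢ (setSlot s h x) + Φʰ m ≡ Φˢ s + slotPotential x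
  Φˢ-setSlot (y ∷ s) zero x {m} refl = xy∙z≈zy∙x (slotPotential x) (Φˢ s) (Φʰ m)
  Φˢ-setSlot (y ∷ s) (suc h) x {m} eq = begin
    slotPotential y + Φˢ (setSlot s h x) + Φʰ m   ≡⟨ +-assoc (slotPotential y) _ _ ⟩
    slotPotential y + (Φˢ (setSlot s h x) + Φʰ m) ≡⟨ cong (slotPotential y +_) (Φˢ-setSlot s h x eq) ⟩
    slotPotential y + (Φˢ s + slotPotential x)    ≡⟨ +-assoc (slotPotential y) _ _ ⟨
    slotPotential y + Φˢ s + slotPotential x      ∎
    where open ≡-Reasoning

  slot-setSlot-≢ : ∀ s {h h'} x → h' ≢ h → slot (setSlot s h x) h' ≡ slot s h'
  slot-setSlot-≢ [] x _ = refl
  slot-setSlot-≢ (y ∷ s) {zero} {zero} x h'≢h = ⊥-elim (h'≢h refl)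
  slot-setSlot-≢ (y ∷ s) {zero} {suc h'} x _ = refl
  slot-setSlot-≢ (y ∷ s) {suc h} {zero} x _ = refl
  slot-setSlot-≢ (y ∷ s) {suc h} {suc h'} x h'≢h = slot-setSlot-≢ s x (h'≢h ∘ cong suc)

  All-setSlot : ∀ {p} {P : Slot → Set p} s h {x} → All P s → P x → All P (setSlot s h x)
  All-setSlot [] _ [] _ = []
  All-setSlot (_ ∷ _) zero (_ ∷ ps) px = px ∷ ps
  All-setSlot (_ ∷ s) (suc h) (py ∷ ps) px = py ∷ All-setSlot s h ps px

  WellShaped-slot : ∀ {s h m} → WellShapedState s → slot s h ≡ live m → WellShapedHeap m
  WellShaped-slot {s} {h} ws eq = subst WellShapedSlot eq (All-slot s h ws)
    where
    All-slot : ∀ s h → WellShapedState s → WellShapedSlot (slot s h)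
    All-slot [] _ [] = tt
    All-slot (_ ∷ _) zero (wx ∷ _) = wx
    All-slot (_ ∷ s) (suc h) (_ ∷ ws) = All-slot s h ws

  amortized-setSlot : ∀ s h {m m' c A} → slot s h ≡ live m → Amortized c A (Φʰ m) (Φʰ m') →
                      Amortized c A (Φˢ s) (Φˢ (setSlot s h (live m')))
  amortized-setSlot s h {m' = m'} eq = amortized-transfer (Φˢ-setSlot s h (live m') eq)

  module Replace = RankPreservingReplacement

  allowance-del : ∀ N → allowance 12 (del N) ≡ 6 * suc (rankBound N)
  allowance-del N = twelve⇒six ⌊log₂ N ⌋
    where
    twelve⇒six : ∀ L → 12 * suc L ≡ 6 * suc (2 * L + 1)
    twelve⇒six = solve-∀

  Φ-decreaseKey : ∀ {e i kt rt cs cs' u k m l} → WellShaped (node i kt rt cs) →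
                  SubL u (proj₁ (dkSplit u k)) cs cs' → item u ≡ just e →
                  Meld (just (node i kt rt cs')) (just (proj₂ (dkSplit u k))) m l →
                  Φʰ m ≤ Φ (node i kt rt cs) + (3 + l)
  Φ-decreaseKey {i = i} {kt} {rt} {cs} {cs'} {u} {k} {m} {l} wt sub it melded =
    +-cancelʳ-≤ (Φ u) _ _ (begin
      Φʰ m + Φ u                 ≡⟨ cong (_+ Φ u) (Φʰ-meld melded) ⟩
      Φ t' + Φ v + l + Φ u       ≡⟨ regroup (Φ t') (Φ v) l (Φ u) ⟩
      (Φ t' + Φ u) + (Φ v + l)   ≡⟨ cong (_+ (Φ v + l)) (Replace.Φ-replace (sym (rank-dkSplit u k)) sub↑) ⟩
      (Φ t + Φ u') + (Φ v + l)   ≡⟨ regroup′ (Φ t) (Φ u') (Φ v) l ⟩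
      Φ t + l + (Φ u' + Φ v)     ≤⟨ +-monoʳ-≤ (Φ t + l) (Φ-dkSplit u k it (WellShaped-sub sub↑ wt)) ⟩
      Φ t + l + (Φ u + 3)        ≡⟨ regroup″ (Φ t) l (Φ u) ⟩
      Φ t + (3 + l) + Φ u        ∎)
    where
    open ≤-Reasoning
    t = node i kt rt cs
    t' = node i kt rt cs'
    u' = proj₁ (dkSplit u k)
    v = proj₂ (dkSplit u k)
    sub↑ : Sub u u' t t'
    sub↑ = below sub
    regroup : ∀ p q l r → p + q + l + r ≡ (p + r) + (q + l)
    regroup = solve-∀
    regroup′ : ∀ p q r l → (p + q) + (r + l) ≡ p + l + (q + r)
    regroup′ = solve-∀
    regroup″ : ∀ p l q → p + l + (q + 3) ≡ p + (3 + l) + q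
    regroup″ = solve-∀

  Φ-deleteNonroot : ∀ {e i kt rt cs cs' u} → WellShaped (node i kt rt cs) →
                    SubL u (hollow u) cs cs' → item u ≡ just e →
                    Φ (node i kt rt cs') ≤ Φ (node i kt rt cs) + suc (rank u)
  Φ-deleteNonroot {i = i} {kt} {rt} {cs} {cs'} {u} wt sub it = +-cancelʳ-≤ (Φ u) _ _ (≤-reflexive (begin
    Φ t' + Φ u                  ≡⟨ Replace.Φ-replace (sym (rank-hollow u)) sub↑ ⟩
    Φ t + Φ (hollow u)          ≡⟨ cong (Φ t +_) (Φ-hollow u it (WellShaped-sub sub↑ wt)) ⟩
    Φ t + (Φ u + suc (rank u))  ≡⟨ x∙yz≈xz∙y (Φ t) (Φ u) _ ⟩
    Φ t + suc (rank u) + Φ u    ∎))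
    where
    open ≡-Reasoning
    t = node i kt rt cs
    t' = node i kt rt cs'
    sub↑ : Sub u (hollow u) t t'
    sub↑ = below sub

  deleteNonroot-amortized : ∀ {e i kt rt cs cs' u} → WellShaped (node i kt rt cs) →
                            SubL u (hollow u) cs cs' → item u ≡ just e →
                            Amortized 1 (allowance 12 (del (size (node i kt rt cs))))
                                      (Φ (node i kt rt cs)) (Φ (node i kt rt cs'))
  deleteNonroot-amortized {i = i} {kt} {rt} {cs} {u = u} wt sub it =
    amortized-from-increase (suc (rank u)) (Φ-deleteNonroot wt sub it)
      (≤-trans (deleteNonroot-arithmetic (rank≤rankBound {N = N} (WellShaped-sub sub↑ wt) (size-sub sub↑)))
               (≤-reflexive (sym (allowance-del N))))
    where
    N = size (node i kt rt cs)
    sub↑ : Sub u (hollow u) (node i kt rt cs) _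
    sub↑ = below sub

  deleteRoot-amortized : ∀ {e k r cs rs m n₁ n₂} → WellShaped (node (just e) k r cs) →
                         RankedPhase (fullRootsL cs) rs n₁ → UnrankedPhase rs m n₂ →
                         Amortized (suc (suc (hollowCountL cs) + length (fullRootsL cs) + n₁ + n₂ + suc (maxRank rs)))
                                   (allowance 12 (del (size (node (just e) k r cs))))
                                   (Φ (node (just e) k r cs)) (Φʰ m)
  deleteRoot-amortized {e} {k} {r} {cs} {rs} {m} {n₁} {n₂} wt@(well-shaped shape wcs) rankedPhase unrankedPhase =
    amortized (begin
      cost + 2 * Φʰ m                   ≡⟨ cong (λ z → cost + 2 * z) Φʰm≡ ⟩
      cost + 2 * (P + n₂)               ≤⟨ deleteRoot-arithmetic {hollowCountL cs} {P = P} {X = Φ t}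
                                             {B = rankBound N} released
                                             (RankedPhase-links≤length rankedPhase) n₂≤1+B
                                             (maxRank≤ rs ranks≤B) (rank≤rankBound {N = N} wt ≤-refl) ⟩
      6 * suc (rankBound N) + 2 * Φ t   ≡⟨ cong (_+ 2 * Φ t) (allowance-del N) ⟨
      allowance 12 (del N) + 2 * Φ t    ∎)
    where
    open ≤-Reasoning
    t = node (just e) k r cs
    N = size t
    P = sum (map Φ (fullRootsL cs))
    cost = suc (suc (hollowCountL cs) + length (fullRootsL cs) + n₁ + n₂ + suc (maxRank rs))
    Φʰm≡ : Φʰ m ≡ P + n₂
    Φʰm≡ = trans (Φʰ-UnrankedPhase unrankedPhase) (cong (_+ n₂) (RankedPhase-sum Φ Φ-rankedLink rankedPhase))
    released : hollowCountL cs + length (fullRootsL cs) + P ≤ r + Φ t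
    released = ≤-trans (fullRootsL-cost cs)
      (≤-reflexive (trans (cong (_+ Φᶜ cs) (length≡rank+unrankedCount shape)) (+-assoc r _ _)))
    ranks≤B : All (λ t → rank t ≤ rankBound N) rs
    ranks≤B = ranks≤rankBound rs (WellShaped-RankedPhase rankedPhase (WellShaped-fullRootsL wcs))
      (≤-trans (≤-reflexive (RankedPhase-sum size size-rankedLink rankedPhase)) (m≤n⇒m≤1+n (size-fullRootsL cs)))
    n₂≤1+B : n₂ ≤ suc (rankBound N)
    n₂≤1+B = ≤-trans (UnrankedPhase-links≤length unrankedPhase)
                     (length≤1+bound rs (RankedPhase-unique rankedPhase) ranks≤B)

  WellShaped-step : ∀ {s s' c k} → Step s s' c k → WellShapedState s → WellShapedState s'
  WellShaped-step make-heap ws = All.++⁺ ws (Maybe.nothing ∷ [])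
  WellShaped-step (find-min _) ws = ws
  WellShaped-step {s} (insert {h = h} _ _ eq _ melded) ws =
    All-setSlot s h ws (WellShaped-meld melded (Maybe.just (well-shaped [] [])) (WellShaped-slot ws eq))
  WellShaped-step {s} (meld {h₁ = h₁} {h₂} _ eq₁ eq₂ melded) ws =
    All-setSlot (setSlot s h₂ dead) h₁ (All-setSlot s h₂ ws tt)
      (WellShaped-meld melded (WellShaped-slot ws eq₁) (WellShaped-slot ws eq₂))
  WellShaped-step {s} (decrease-key-root {h = h} _ eq _) ws with Maybe.drop-just (WellShaped-slot ws eq)
  ... | well-shaped shape wcs = All-setSlot s h ws (Maybe.just (well-shaped shape wcs))
  WellShaped-step {s} (decrease-key {h = h} {u = u} _ k eq sub it _ melded) ws =
    All-setSlot s h ws (WellShaped-meld melded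
      (Maybe.just (Replace.WellShaped-replace (sym (rank-dkSplit u k)) (below sub) wt (proj₁ split)))
      (Maybe.just (proj₂ split)))
    where
    wt = Maybe.drop-just (WellShaped-slot ws eq)
    split = WellShaped-dkSplit u k it (WellShaped-sub (below sub) wt)
  WellShaped-step {s} (delete-nonroot {h = h} {u = u} _ eq sub it) ws =
    All-setSlot s h ws (Maybe.just (Replace.WellShaped-replace (sym (rank-hollow u)) (below sub) wt
      (WellShaped-hollow u it (WellShaped-sub (below sub) wt))))
    where
    wt = Maybe.drop-just (WellShaped-slot ws eq)
  WellShaped-step {s} (delete-root {h = h} eq rankedPhase unrankedPhase) ws
    with Maybe.drop-just (WellShaped-slot ws eq)
  ... | well-shaped _ wcs = All-setSlot s h ws
    (WellShaped-UnrankedPhase unrankedPhase (WellShaped-RankedPhase rankedPhase (WellShaped-fullRootsL wcs)))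

  Φˢ-∷ʳ-empty : ∀ s → Φˢ (s ++ [ live nothing ]) ≡ Φˢ s
  Φˢ-∷ʳ-empty s = trans (sum-map-++ slotPotential s _) (+-identityʳ _)

  Φˢ-meld : ∀ s {h₁ h₂ m₁ m₂} m → h₁ ≢ h₂ → slot s h₁ ≡ live m₁ → slot s h₂ ≡ live m₂ →
            Φˢ (setSlot (setSlot s h₂ dead) h₁ (live m)) + (Φʰ m₁ + Φʰ m₂) ≡ Φˢ s + Φʰ m
  Φˢ-meld s {h₁} {h₂} {m₁} {m₂} m h₁≢h₂ eq₁ eq₂ = begin
      Φˢ s″ + (Φʰ m₁ + Φʰ m₂)   ≡⟨ +-assoc (Φˢ s″) _ _ ⟨
      Φˢ s″ + Φʰ m₁ + Φʰ m₂     ≡⟨ cong (_+ Φʰ m₂) (Φˢ-setSlot s₁ h₁ (live m) eq₁′) ⟩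
      Φˢ s₁ + Φʰ m + Φʰ m₂      ≡⟨ xy∙z≈xz∙y (Φˢ s₁) _ _ ⟩
      Φˢ s₁ + Φʰ m₂ + Φʰ m      ≡⟨ cong (_+ Φʰ m) (trans (Φˢ-setSlot s h₂ dead eq₂) (+-identityʳ _)) ⟩
      Φˢ s + Φʰ m               ∎
    where
    open ≡-Reasoning
    s₁ = setSlot s h₂ dead
    s″ = setSlot s₁ h₁ (live m)
    eq₁′ : slot s₁ h₁ ≡ live m₁
    eq₁′ = trans (slot-setSlot-≢ s dead h₁≢h₂) eq₁

  step-amortized : ∀ {s s' c k} → Step s s' c k → WellShapedState s → Amortized c (allowance 12 k) (Φˢ s) (Φˢ s')
  step-amortized {s} make-heap _ =
    amortized (≤-trans (≤-reflexive (cong (λ z → 1 + 2 * z) (Φˢ-∷ʳ-empty s)))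
                       (+-monoˡ-≤ (2 * Φˢ s) (s≤s (z≤n {11}))))
  step-amortized {s} (find-min _) _ = amortized (+-monoˡ-≤ (2 * Φˢ s) (s≤s (z≤n {11})))
  step-amortized {s} (insert {h = h} {l = l} _ _ eq _ melded) _ =
    amortized-setSlot s h eq (amortized-from-increase l (≤-reflexive (Φʰ-meld melded))
      (cheapOperation-arithmetic (meld-links≤1 melded) (m≤n+m l 3)))
  step-amortized {s} (meld {m = m} {l = l} h₁≢h₂ eq₁ eq₂ melded) _ =
    amortized-transfer (Φˢ-meld s m h₁≢h₂ eq₁ eq₂) (amortized-from-increase l (≤-reflexive (Φʰ-meld melded))
      (cheapOperation-arithmetic (meld-links≤1 melded) (m≤n+m l 3)))
  step-amortized {s} (decrease-key-root {h = h} _ eq _) _ =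
    amortized-setSlot s h eq (amortized (+-monoˡ-≤ _ (s≤s (z≤n {11}))))
  step-amortized {s} (decrease-key {h = h} {l = l} _ _ eq sub it _ melded) ws =
    amortized-setSlot s h eq (amortized-from-increase (3 + l)
      (Φ-decreaseKey (Maybe.drop-just (WellShaped-slot ws eq)) sub it melded)
      (cheapOperation-arithmetic (meld-links≤1 melded) ≤-refl))
  step-amortized {s} (delete-nonroot {h = h} _ eq sub it) ws =
    amortized-setSlot s h eq (deleteNonroot-amortized (Maybe.drop-just (WellShaped-slot ws eq)) sub it)
  step-amortized {s} (delete-root {h = h} eq rankedPhase unrankedPhase) ws =
    amortized-setSlot s h eq (deleteRoot-amortized (Maybe.drop-just (WellShaped-slot ws eq)) rankedPhase unrankedPhase)

  exec-amortized : ∀ {s s' cost ks} → Exec s s' cost ks → WellShapedState s →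
                   Amortized cost (sum (map (allowance 12) ks)) (Φˢ s) (Φˢ s')
  exec-amortized [] _ = amortized ≤-refl
  exec-amortized (step ∷ steps) ws = amortized-++ (step-amortized step ws) (exec-amortized steps (WellShaped-step step ws))

theorem3p4 : ∀ {a ℓ₁ ℓ₂} (O : TotalOrder a ℓ₁ ℓ₂) →
    let open HollowHeap O in
      Σ ℕ (λ c → ∀ {s cost ks} → Exec [] s cost ks →
                   cost ≤ sum (map (allowance c) ks))
theorem3p4 O = 12 , λ run → amortized⇒≤ (exec-amortized run [])
  where open Analysis O
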